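{- For every $n>2$ and all integers $p,q$, $$b_{n,p,q}=a_{n-1,p,q-1}-a_{n-2,p-1,q-1}+a_{n-2,p-1,q}.$$
   Context: A Dyck path of semilength $n$ is a lattice path from $(0,0)$ consisting of $n$ up steps $U=(1,1)$ and $n$ down steps $D=(1,-1)$, never going below the $x$-axis and ending on the $x$-axis. A return is a down step ending on the $x$-axis; a Dyck path is irreducible if it has exactly one return. A valley is an occurrence of consecutive steps $DU$; a triple fall is an occurrence of consecutive steps $DDD$. Let $a_{n,p,q}$ be the number of Dyck paths of semilength $n$ with $p$ valleys and $q$ triple falls, and $b_{n,p,q}$ the number of irreducible Dyck paths of semilength $n$ with $p$ valleys and $q$ triple falls; these numbers are $0$ when some index is negative. -}

module Defs where

open import Data.Nat using (ℕ; zero; suc; _+_; _*_)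
open import Data.Integer using (ℤ; +_; -[1+_])
open import Data.Bool using (Bool; true; false; _∧_)
open import Data.List using (List; []; _∷_; map; _++_; concatMap; filter; length)
open import Relation.Nullary using (Dec; yes; no)
open import Relation.Binary.PropositionalEquality using (_≡_)
import Data.Nat as ℕ
open import Data.Bool using (T)
open import Relation.Nullary.Decidable using (_×-dec_)
open import Data.Bool.Properties using (T?)
open import Data.Product using (_×_)

-- Steps of a lattice path: U = (1,1), D = (1,-1).
data Step : Set where
  U D : Step

words : ℕ → List (List Step)
words zero    = [] ∷ []
words (suc m) = map (U ∷_) (words m) ++ map (D ∷_) (words m)

dyckFrom : ℕ → List Step → Bool
dyckFrom zero    []       = true
dyckFrom (suc h) []       = false
dyckFrom h       (U ∷ w)  = dyckFrom (suc h) w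
dyckFrom zero    (D ∷ w)  = false
dyckFrom (suc h) (D ∷ w)  = dyckFrom h w

isDyck : List Step → Bool
isDyck = dyckFrom zero

returnsFrom : ℕ → List Step → ℕ
returnsFrom h       []      = zero
returnsFrom h       (U ∷ w) = returnsFrom (suc h) w
returnsFrom zero    (D ∷ w) = returnsFrom zero w   -- unreachable for Dyck paths
returnsFrom (suc zero)    (D ∷ w) = suc (returnsFrom zero w)
returnsFrom (suc (suc h)) (D ∷ w) = returnsFrom (suc h) w

returns : List Step → ℕ
returns = returnsFrom zero

valleys : List Step → ℕ
valleys []            = zero
valleys (D ∷ U ∷ w)   = suc (valleys (U ∷ w))
valleys (_ ∷ w)       = valleys w

-- Number of triple falls: occurrences of consecutive steps DDD
-- (occurrences may overlap, e.g. DDDD contains two).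
tripleFalls : List Step → ℕ
tripleFalls []              = zero
tripleFalls (D ∷ D ∷ D ∷ w) = suc (tripleFalls (D ∷ D ∷ w))
tripleFalls (_ ∷ w)         = tripleFalls w

dyckPaths : ℕ → List (List Step)
dyckPaths n = filter (λ w → T? (isDyck w)) (words (2 * n))

irreduciblePaths : ℕ → List (List Step)
irreduciblePaths n = filter (λ w → returns w ℕ.≟ 1) (dyckPaths n)

countVT : ℕ → ℕ → List (List Step) → ℕ
countVT p q ws = length (filter (λ w → (valleys w ℕ.≟ p) ×-dec (tripleFalls w ℕ.≟ q)) ws)

a : ℤ → ℤ → ℤ → ℤ
a (+ n) (+ p) (+ q) = + countVT p q (dyckPaths n)
a _ _ _ = + 0

b : ℤ → ℤ → ℤ → ℤ
b (+ n) (+ p) (+ q) = + countVT p q (irreduciblePaths n)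
b _ _ _ = + 0

-- An irreducible Dyck path of semilength n is U u D with u a Dyck path of semilength n - 1;
-- it has the valleys of u, and one triple fall more than u exactly when u ends in DD.
-- For n > 2 the path u ends either in DD, where appending D adds one triple fall, or in UD,
-- and then u = x U D with x a nonempty Dyck path having one valley fewer and the same triple
-- falls. Comparing b(n,p,q) with a(n-1,p,q-1), the paths u ending in DD contribute equally
-- to both, and those ending in UD account for a(n-2,p-1,q) - a(n-2,p-1,q-1).
module Submission where

open import Defs
open import Data.Bool using (Bool; true; false; _∧_)
open import Data.Bool.Properties using (∧-assoc; ∧-zeroʳ)
open import Data.Integer using (ℤ; +_; -[1+_]; _+_; _-_; _>_; +<+)
open import Data.Integer.Properties using (_≟_; pos-+)
import Data.Integer.Tactic.RingSolver as ℤ-Solver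
open import Data.List using (List; []; _∷_; _++_; _∷ʳ_; map; filter; length)
open import Data.List.Properties using (++-assoc; map-++; map-∘)
open import Data.Nat.ListAction using (sum)
open import Data.Nat.ListAction.Properties using (sum-++)
open import Data.Nat as ℕ using (ℕ; zero; suc; _≡ᵇ_; s≤s)
open import Data.Nat.Properties using (+-identityʳ; +-commutativeSemigroup)
import Data.Nat.Tactic.RingSolver as ℕ-Solver
open import Algebra.Properties.CommutativeSemigroup +-commutativeSemigroup using (interchange; xy∙z≈zy∙x)
open import Function using (_∘_)
open import Relation.Nullary using (does)
open import Relation.Unary using (Decidable)
open import Relation.Binary.PropositionalEquality using (_≡_; refl; sym; trans; cong; cong₂; module ≡-Reasoning)

χ : Bool → ℕ
χ false = 0
χ true  = 1

sumWords : ℕ → (List Step → ℕ) → ℕ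
sumWords zero    f = f []
sumWords (suc m) f = sumWords m (f ∘ (U ∷_)) ℕ.+ sumWords m (f ∘ (D ∷_))

sumWords-cong : ∀ m {f g : List Step → ℕ} → (∀ w → f w ≡ g w) → sumWords m f ≡ sumWords m g
sumWords-cong zero    f≡g = f≡g []
sumWords-cong (suc m) f≡g =
  cong₂ ℕ._+_ (sumWords-cong m (f≡g ∘ (U ∷_))) (sumWords-cong m (f≡g ∘ (D ∷_)))

sumWords-zero : ∀ m {f : List Step → ℕ} → (∀ w → f w ≡ 0) → sumWords m f ≡ 0
sumWords-zero zero    f≡0 = f≡0 []
sumWords-zero (suc m) f≡0 =
  cong₂ ℕ._+_ (sumWords-zero m (f≡0 ∘ (U ∷_))) (sumWords-zero m (f≡0 ∘ (D ∷_)))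

sumWords-+ : ∀ m (f g : List Step → ℕ) →
  sumWords m (λ w → f w ℕ.+ g w) ≡ sumWords m f ℕ.+ sumWords m g
sumWords-+ zero    f g = refl
sumWords-+ (suc m) f g = trans
  (cong₂ ℕ._+_ (sumWords-+ m (f ∘ (U ∷_)) (g ∘ (U ∷_))) (sumWords-+ m (f ∘ (D ∷_)) (g ∘ (D ∷_))))
  (interchange (sumWords m (f ∘ (U ∷_))) (sumWords m (g ∘ (U ∷_)))
               (sumWords m (f ∘ (D ∷_))) (sumWords m (g ∘ (D ∷_))))

sumWords-++ : ∀ m k (f : List Step → ℕ) →
  sumWords (m ℕ.+ k) f ≡ sumWords m (λ x → sumWords k (λ y → f (x ++ y)))
sumWords-++ zero    k f = refl
sumWords-++ (suc m) k f = cong₂ ℕ._+_ (sumWords-++ m k (f ∘ (U ∷_))) (sumWords-++ m k (f ∘ (D ∷_)))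

sum-map-words : ∀ m (f : List Step → ℕ) → sum (map f (words m)) ≡ sumWords m f
sum-map-words zero    f = +-identityʳ (f [])
sum-map-words (suc m) f = begin
  sum (map f (map (U ∷_) ws ++ map (D ∷_) ws))
    ≡⟨ cong sum (map-++ f (map (U ∷_) ws) (map (D ∷_) ws)) ⟩
  sum (map f (map (U ∷_) ws) ++ map f (map (D ∷_) ws))
    ≡⟨ sum-++ (map f (map (U ∷_) ws)) (map f (map (D ∷_) ws)) ⟩
  sum (map f (map (U ∷_) ws)) ℕ.+ sum (map f (map (D ∷_) ws))
    ≡⟨ cong₂ ℕ._+_ (cong sum (sym (map-∘ ws))) (cong sum (sym (map-∘ ws))) ⟩
  sum (map (f ∘ (U ∷_)) ws) ℕ.+ sum (map (f ∘ (D ∷_)) ws)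
    ≡⟨ cong₂ ℕ._+_ (sum-map-words m (f ∘ (U ∷_))) (sum-map-words m (f ∘ (D ∷_))) ⟩
  sumWords (suc m) f ∎
  where
  open ≡-Reasoning
  ws = words m

length-filter : ∀ {P : List Step → Set} (P? : Decidable P) (xs : List (List Step)) →
  length (filter P? xs) ≡ sum (map (χ ∘ does ∘ P?) xs)
length-filter P? []       = refl
length-filter P? (x ∷ xs) with does (P? x)
... | true  = cong suc (length-filter P? xs)
... | false = length-filter P? xs

sum-map-χ-filter : ∀ {P : List Step → Set} (P? : Decidable P) (g : List Step → Bool) xs →
  sum (map (χ ∘ g) (filter P? xs)) ≡ sum (map (λ x → χ (does (P? x) ∧ g x)) xs)
sum-map-χ-filter P? g []       = refl
sum-map-χ-filter P? g (x ∷ xs) with does (P? x)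
... | true  = cong (χ (g x) ℕ.+_) (sum-map-χ-filter P? g xs)
... | false = sum-map-χ-filter P? g xs

dyckFrom-∷ʳ-U : ∀ h w → dyckFrom h (w ∷ʳ U) ≡ false
dyckFrom-∷ʳ-U zero    []      = refl
dyckFrom-∷ʳ-U (suc h) []      = refl
dyckFrom-∷ʳ-U zero    (U ∷ w) = dyckFrom-∷ʳ-U (suc zero) w
dyckFrom-∷ʳ-U (suc h) (U ∷ w) = dyckFrom-∷ʳ-U (suc (suc h)) w
dyckFrom-∷ʳ-U zero    (D ∷ w) = refl
dyckFrom-∷ʳ-U (suc h) (D ∷ w) = dyckFrom-∷ʳ-U h w

dyckFrom-++-∷-U : ∀ h x s → dyckFrom h (x ++ s ∷ U ∷ []) ≡ false
dyckFrom-++-∷-U h x s = trans (cong (dyckFrom h) (sym (++-assoc x (s ∷ []) (U ∷ [])))) (dyckFrom-∷ʳ-U h (x ∷ʳ s))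

dyckFrom-++-UD : ∀ h w → dyckFrom h (w ++ U ∷ D ∷ []) ≡ dyckFrom h w
dyckFrom-++-UD zero    []      = refl
dyckFrom-++-UD (suc h) []      = refl
dyckFrom-++-UD zero    (U ∷ w) = dyckFrom-++-UD (suc zero) w
dyckFrom-++-UD (suc h) (U ∷ w) = dyckFrom-++-UD (suc (suc h)) w
dyckFrom-++-UD zero    (D ∷ w) = refl
dyckFrom-++-UD (suc h) (D ∷ w) = dyckFrom-++-UD h w

-- Phrased with `≡ᵇ 0` because a final step down from height 1 turns the test `suc r ≡ᵇ 1`
-- in dyckFrom-∷ʳ-D-singleReturn into `r ≡ᵇ 0`.
dyckFrom-∷ʳ-D-hasReturn : ∀ h w → dyckFrom h (w ∷ʳ D) ∧ (returnsFrom h (w ∷ʳ D) ≡ᵇ 0) ≡ false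
dyckFrom-∷ʳ-D-hasReturn zero          []      = refl
dyckFrom-∷ʳ-D-hasReturn (suc zero)    []      = refl
dyckFrom-∷ʳ-D-hasReturn (suc (suc h)) []      = refl
dyckFrom-∷ʳ-D-hasReturn zero          (U ∷ w) = dyckFrom-∷ʳ-D-hasReturn (suc zero) w
dyckFrom-∷ʳ-D-hasReturn (suc h)       (U ∷ w) = dyckFrom-∷ʳ-D-hasReturn (suc (suc h)) w
dyckFrom-∷ʳ-D-hasReturn zero          (D ∷ w) = refl
dyckFrom-∷ʳ-D-hasReturn (suc zero)    (D ∷ w) = ∧-zeroʳ (dyckFrom zero (w ∷ʳ D))
dyckFrom-∷ʳ-D-hasReturn (suc (suc h)) (D ∷ w) = dyckFrom-∷ʳ-D-hasReturn (suc h) w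

dyckFrom-∷ʳ-D-singleReturn : ∀ h w →
  dyckFrom (suc h) (w ∷ʳ D) ∧ (returnsFrom (suc h) (w ∷ʳ D) ≡ᵇ 1) ≡ dyckFrom h w
dyckFrom-∷ʳ-D-singleReturn zero    []      = refl
dyckFrom-∷ʳ-D-singleReturn (suc h) []      = refl
dyckFrom-∷ʳ-D-singleReturn zero    (U ∷ w) = dyckFrom-∷ʳ-D-singleReturn (suc zero) w
dyckFrom-∷ʳ-D-singleReturn (suc h) (U ∷ w) = dyckFrom-∷ʳ-D-singleReturn (suc (suc h)) w
dyckFrom-∷ʳ-D-singleReturn zero    (D ∷ w) = dyckFrom-∷ʳ-D-hasReturn zero w
dyckFrom-∷ʳ-D-singleReturn (suc h) (D ∷ w) = dyckFrom-∷ʳ-D-singleReturn h w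

valleys-∷ʳ-D : ∀ w → valleys (w ∷ʳ D) ≡ valleys w
valleys-∷ʳ-D []          = refl
valleys-∷ʳ-D (U ∷ w)     = valleys-∷ʳ-D w
valleys-∷ʳ-D (D ∷ [])    = refl
valleys-∷ʳ-D (D ∷ U ∷ w) = cong suc (valleys-∷ʳ-D (U ∷ w))
valleys-∷ʳ-D (D ∷ D ∷ w) = valleys-∷ʳ-D (D ∷ w)

valleys-++-UD : ∀ h s w → dyckFrom h (s ∷ w) ≡ true →
  valleys (s ∷ w ++ U ∷ D ∷ []) ≡ suc (valleys (s ∷ w))
valleys-++-UD zero    U []      ()
valleys-++-UD (suc h) U []      ()
valleys-++-UD h       D []      _    = refl
valleys-++-UD zero    U (t ∷ w) dyck = valleys-++-UD (suc zero) t w dyck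
valleys-++-UD (suc h) U (t ∷ w) dyck = valleys-++-UD (suc (suc h)) t w dyck
valleys-++-UD zero    D (t ∷ w) ()
valleys-++-UD (suc h) D (U ∷ w) dyck = cong suc (valleys-++-UD h U w dyck)
valleys-++-UD (suc h) D (D ∷ w) dyck = valleys-++-UD h D w dyck

tripleFalls-++-U : ∀ x r → tripleFalls (x ++ U ∷ r) ≡ tripleFalls x ℕ.+ tripleFalls r
tripleFalls-++-U []                  r = refl
tripleFalls-++-U (U ∷ x)             r = tripleFalls-++-U x r
tripleFalls-++-U (D ∷ [])            r = refl
tripleFalls-++-U (D ∷ U ∷ x)         r = tripleFalls-++-U x r
tripleFalls-++-U (D ∷ D ∷ [])        r = refl
tripleFalls-++-U (D ∷ D ∷ U ∷ x)     r = tripleFalls-++-U x r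
tripleFalls-++-U (D ∷ D ∷ D ∷ x)     r = cong suc (tripleFalls-++-U (D ∷ D ∷ x) r)

tripleFalls-++-DD-∷ʳ-D : ∀ y → tripleFalls ((y ++ D ∷ D ∷ []) ∷ʳ D) ≡ suc (tripleFalls (y ++ D ∷ D ∷ []))
tripleFalls-++-DD-∷ʳ-D []              = refl
tripleFalls-++-DD-∷ʳ-D (U ∷ y)         = tripleFalls-++-DD-∷ʳ-D y
tripleFalls-++-DD-∷ʳ-D (D ∷ [])        = refl
tripleFalls-++-DD-∷ʳ-D (D ∷ U ∷ y)     = tripleFalls-++-DD-∷ʳ-D y
tripleFalls-++-DD-∷ʳ-D (D ∷ D ∷ [])    = refl
tripleFalls-++-DD-∷ʳ-D (D ∷ D ∷ U ∷ y) = tripleFalls-++-DD-∷ʳ-D y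
tripleFalls-++-DD-∷ʳ-D (D ∷ D ∷ D ∷ y) = cong suc (tripleFalls-++-DD-∷ʳ-D (D ∷ D ∷ y))

tripleFalls-++-UD : ∀ x → tripleFalls (x ++ U ∷ D ∷ []) ≡ tripleFalls x
tripleFalls-++-UD x = trans (tripleFalls-++-U x (D ∷ [])) (+-identityʳ (tripleFalls x))

tripleFalls-++-UD-∷ʳ-D : ∀ x → tripleFalls ((x ++ U ∷ D ∷ []) ∷ʳ D) ≡ tripleFalls x
tripleFalls-++-UD-∷ʳ-D x = trans (cong tripleFalls (++-assoc x (U ∷ D ∷ []) (D ∷ [])))
                                 (trans (tripleFalls-++-U x (D ∷ D ∷ [])) (+-identityʳ (tripleFalls x)))

dyckCount : ℕ → (List Step → Bool) → ℕ
dyckCount m g = sumWords m (λ w → χ (isDyck w ∧ g w))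

irreducibleCount : ℕ → (List Step → Bool) → ℕ
irreducibleCount m g = sumWords m (λ w → χ ((isDyck w ∧ (returns w ≡ᵇ 1)) ∧ g w))

dyckCount-cong : ∀ m {g g' : List Step → Bool} → (∀ w → g w ≡ g' w) → dyckCount m g ≡ dyckCount m g'
dyckCount-cong m g≡g' = sumWords-cong m (λ w → cong (χ ∘ (isDyck w ∧_)) (g≡g' w))

dyckCount-cong-∷ : ∀ m {g g' : List Step → Bool} →
  (∀ s w → isDyck (s ∷ w) ≡ true → g (s ∷ w) ≡ g' (s ∷ w)) → dyckCount (suc m) g ≡ dyckCount (suc m) g'
dyckCount-cong-∷ m {g} {g'} g≡g' = cong₂ ℕ._+_ (sumWords-cong m (summand U)) (sumWords-cong m (summand D))
  where
  summand : ∀ s w → χ (isDyck (s ∷ w) ∧ g (s ∷ w)) ≡ χ (isDyck (s ∷ w) ∧ g' (s ∷ w))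
  summand s w with isDyck (s ∷ w) in dyck
  ... | false = refl
  ... | true  = cong χ (g≡g' s w dyck)

irreducibleCount-U∷-∷ʳ-D : ∀ m g → irreducibleCount (suc (m ℕ.+ 1)) g ≡ dyckCount m (λ u → g (U ∷ u ∷ʳ D))
irreducibleCount-U∷-∷ʳ-D m g =
  trans (cong₂ ℕ._+_ (sumWords-++ m 1 _) (sumWords-zero (m ℕ.+ 1) (λ _ → refl)))
  (trans (+-identityʳ _) (sumWords-cong m summand))
  where
  summand : ∀ u → χ ((dyckFrom 1 (u ∷ʳ U) ∧ (returnsFrom 1 (u ∷ʳ U) ≡ᵇ 1)) ∧ g (U ∷ u ∷ʳ U))
                  ℕ.+ χ ((dyckFrom 1 (u ∷ʳ D) ∧ (returnsFrom 1 (u ∷ʳ D) ≡ᵇ 1)) ∧ g (U ∷ u ∷ʳ D))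
                ≡ χ (isDyck u ∧ g (U ∷ u ∷ʳ D))
  summand u rewrite dyckFrom-∷ʳ-U 1 u | dyckFrom-∷ʳ-D-singleReturn 0 u = refl

-- Indexed by the length m of the prefix y; the paths counted have length m + 2.
dyckEndingDDCount : ℕ → (List Step → Bool) → ℕ
dyckEndingDDCount m g = sumWords m (λ y → χ (isDyck (y ++ D ∷ D ∷ []) ∧ g (y ++ D ∷ D ∷ [])))

dyckCount-split : ∀ m g →
  dyckCount (m ℕ.+ 2) g ≡ dyckCount m (λ x → g (x ++ U ∷ D ∷ [])) ℕ.+ dyckEndingDDCount m g
dyckCount-split m g = trans (sumWords-++ m 2 _) (trans (sumWords-cong m summand) (sumWords-+ m _ _))
  where
  weight : List Step → ℕ
  weight w = χ (isDyck w ∧ g w)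
  summand : ∀ x → (weight (x ++ U ∷ U ∷ []) ℕ.+ weight (x ++ U ∷ D ∷ []))
                  ℕ.+ (weight (x ++ D ∷ U ∷ []) ℕ.+ weight (x ++ D ∷ D ∷ []))
                ≡ χ (isDyck x ∧ g (x ++ U ∷ D ∷ [])) ℕ.+ weight (x ++ D ∷ D ∷ [])
  summand x rewrite dyckFrom-++-∷-U 0 x U | dyckFrom-++-∷-U 0 x D | dyckFrom-++-UD 0 x = refl

hasStats : (ℕ → ℕ → Bool) → List Step → Bool
hasStats P w = P (valleys w) (tripleFalls w)

dyckCount-split-hasStats : ∀ j (P : ℕ → ℕ → Bool) →
  dyckCount (suc j ℕ.+ 2) (hasStats P)
  ≡ dyckCount (suc j) (hasStats (λ v t → P (suc v) t)) ℕ.+ dyckEndingDDCount (suc j) (hasStats P)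
dyckCount-split-hasStats j P = trans (dyckCount-split (suc j) (hasStats P))
  (cong (ℕ._+ dyckEndingDDCount (suc j) (hasStats P))
        (dyckCount-cong-∷ j {λ x → hasStats P (x ++ U ∷ D ∷ [])} {hasStats (λ v t → P (suc v) t)} strip))
  where
  strip : ∀ s w → isDyck (s ∷ w) ≡ true →
    hasStats P (s ∷ w ++ U ∷ D ∷ []) ≡ hasStats (λ v t → P (suc v) t) (s ∷ w)
  strip s w dyck = cong₂ P (valleys-++-UD 0 s w dyck) (tripleFalls-++-UD (s ∷ w))

dyckCount-split-hasStats-∷ʳ-D : ∀ j (P : ℕ → ℕ → Bool) →
  dyckCount (suc j ℕ.+ 2) (λ u → hasStats P (u ∷ʳ D))
  ≡ dyckCount (suc j) (hasStats (λ v t → P (suc v) t))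
    ℕ.+ dyckEndingDDCount (suc j) (hasStats (λ v t → P v (suc t)))
dyckCount-split-hasStats-∷ʳ-D j P = trans (dyckCount-split (suc j) (λ u → hasStats P (u ∷ʳ D)))
  (cong₂ ℕ._+_
    (dyckCount-cong-∷ j {λ x → hasStats P ((x ++ U ∷ D ∷ []) ∷ʳ D)} {hasStats (λ v t → P (suc v) t)} strip)
    (sumWords-cong (suc j) {g = λ y → χ (isDyck (y ++ D ∷ D ∷ []) ∧ hasStats (λ v t → P v (suc t)) (y ++ D ∷ D ∷ []))}
      (λ y → cong (λ b → χ (isDyck (y ++ D ∷ D ∷ []) ∧ b))
                  (cong₂ P (valleys-∷ʳ-D (y ++ D ∷ D ∷ [])) (tripleFalls-++-DD-∷ʳ-D y)))))
  where
  strip : ∀ s w → isDyck (s ∷ w) ≡ true →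
    hasStats P ((s ∷ w ++ U ∷ D ∷ []) ∷ʳ D) ≡ hasStats (λ v t → P (suc v) t) (s ∷ w)
  strip s w dyck = cong₂ P (trans (valleys-∷ʳ-D (s ∷ w ++ U ∷ D ∷ [])) (valleys-++-UD 0 s w dyck))
                           (tripleFalls-++-UD-∷ʳ-D (s ∷ w))

irreducibleCount-recurrence : ∀ j (P : ℕ → ℕ → Bool) →
  irreducibleCount (suc (suc j ℕ.+ 2 ℕ.+ 1)) (hasStats P)
    ℕ.+ dyckCount (suc j) (hasStats (λ v t → P (suc v) (suc t)))
  ≡ dyckCount (suc j ℕ.+ 2) (hasStats (λ v t → P v (suc t)))
    ℕ.+ dyckCount (suc j) (hasStats (λ v t → P (suc v) t))
irreducibleCount-recurrence j P = begin
  irreducibleCount (suc (suc j ℕ.+ 2 ℕ.+ 1)) (hasStats P) ℕ.+ K₁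
    ≡⟨ cong (ℕ._+ K₁) (irreducibleCount-U∷-∷ʳ-D (suc j ℕ.+ 2) (hasStats P)) ⟩
  dyckCount (suc j ℕ.+ 2) (λ u → hasStats P (u ∷ʳ D)) ℕ.+ K₁
    ≡⟨ cong (ℕ._+ K₁) (dyckCount-split-hasStats-∷ʳ-D j P) ⟩
  (K₂ ℕ.+ Y) ℕ.+ K₁
    ≡⟨ xy∙z≈zy∙x K₂ Y K₁ ⟩
  (K₁ ℕ.+ Y) ℕ.+ K₂
    ≡⟨ cong (ℕ._+ K₂) (dyckCount-split-hasStats j (λ v t → P v (suc t))) ⟨
  dyckCount (suc j ℕ.+ 2) (hasStats (λ v t → P v (suc t))) ℕ.+ K₂ ∎
  where
  open ≡-Reasoning
  K₁ K₂ Y : ℕ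
  K₁ = dyckCount (suc j) (hasStats (λ v t → P (suc v) (suc t)))
  K₂ = dyckCount (suc j) (hasStats (λ v t → P (suc v) t))
  Y  = dyckEndingDDCount (suc j) (hasStats (λ v t → P v (suc t)))

irreducibleCount-recurrence-semilength : ∀ n (P : ℕ → ℕ → Bool) →
  irreducibleCount (2 ℕ.* (3 ℕ.+ n)) (hasStats P)
    ℕ.+ dyckCount (2 ℕ.* (1 ℕ.+ n)) (hasStats (λ v t → P (suc v) (suc t)))
  ≡ dyckCount (2 ℕ.* (2 ℕ.+ n)) (hasStats (λ v t → P v (suc t)))
    ℕ.+ dyckCount (2 ℕ.* (1 ℕ.+ n)) (hasStats (λ v t → P (suc v) t))
irreducibleCount-recurrence-semilength n P =
  trans (cong₂ ℕ._+_ (cong (λ L → irreducibleCount L (hasStats P)) (length₃ n))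
                     (cong (λ L → dyckCount L (hasStats (λ v t → P (suc v) (suc t)))) (length₁ n)))
  (trans (irreducibleCount-recurrence (suc (2 ℕ.* n)) P)
  (sym (cong₂ ℕ._+_ (cong (λ L → dyckCount L (hasStats (λ v t → P v (suc t)))) (length₂ n))
                    (cong (λ L → dyckCount L (hasStats (λ v t → P (suc v) t))) (length₁ n)))))
  where
  open ℕ-Solver using (solve-∀)
  length₃ : ∀ n → 2 ℕ.* (3 ℕ.+ n) ≡ suc (suc (suc (2 ℕ.* n)) ℕ.+ 2 ℕ.+ 1)
  length₃ = solve-∀
  length₂ : ∀ n → 2 ℕ.* (2 ℕ.+ n) ≡ suc (suc (2 ℕ.* n)) ℕ.+ 2
  length₂ = solve-∀
  length₁ : ∀ n → 2 ℕ.* (1 ℕ.+ n) ≡ suc (suc (2 ℕ.* n))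
  length₁ = solve-∀

-- False at negative targets, which matches a and b vanishing at negative indices.
_≟ᵇ_ : ℕ → ℤ → Bool
v ≟ᵇ z = does (+ v ≟ z)

suc-≟ᵇ : ∀ v z → suc v ≟ᵇ z ≡ v ≟ᵇ (z - + 1)
suc-≟ᵇ v (+ zero)  = refl
suc-≟ᵇ v (+ suc n) = refl
suc-≟ᵇ v -[1+ n ]  = refl

statsAre : ℤ → ℤ → ℕ → ℕ → Bool
statsAre p q v t = (v ≟ᵇ p) ∧ (t ≟ᵇ q)

sumWords-χ-∧-false : ∀ m (c : List Step → Bool) {g : List Step → Bool} → (∀ w → g w ≡ false) →
  sumWords m (λ w → χ (c w ∧ g w)) ≡ 0
sumWords-χ-∧-false m c g≡false = sumWords-zero m (λ w → cong χ (trans (cong (c w ∧_) (g≡false w)) (∧-zeroʳ (c w))))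

a≡dyckCount : ∀ n p q → a (+ n) p q ≡ + dyckCount (2 ℕ.* n) (hasStats (statsAre p q))
a≡dyckCount n (+ p) (+ q) = cong +_
  (trans (length-filter _ (dyckPaths n))
  (trans (sum-map-χ-filter _ _ (words (2 ℕ.* n))) (sum-map-words (2 ℕ.* n) _)))
a≡dyckCount n (+ p) -[1+ q ] = sym (cong +_ (sumWords-χ-∧-false (2 ℕ.* n) isDyck (λ w → ∧-zeroʳ (valleys w ≡ᵇ p))))
a≡dyckCount n -[1+ p ] q = sym (cong +_ (sumWords-χ-∧-false (2 ℕ.* n) isDyck (λ w → refl)))

b≡irreducibleCount : ∀ n p q → b (+ n) p q ≡ + irreducibleCount (2 ℕ.* n) (hasStats (statsAre p q))
b≡irreducibleCount n (+ p) (+ q) = cong +_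
  (trans (length-filter _ (filter _ (dyckPaths n)))
  (trans (sum-map-χ-filter _ _ (dyckPaths n))
  (trans (sum-map-χ-filter _ _ (words (2 ℕ.* n)))
  (trans (sum-map-words (2 ℕ.* n) _)
         (sumWords-cong (2 ℕ.* n) (λ w → cong χ (sym (∧-assoc (isDyck w) _ _))))))))
b≡irreducibleCount n (+ p) -[1+ q ] =
  sym (cong +_ (sumWords-χ-∧-false (2 ℕ.* n) (λ w → isDyck w ∧ (returns w ≡ᵇ 1)) (λ w → ∧-zeroʳ (valleys w ≡ᵇ p))))
b≡irreducibleCount n -[1+ p ] q = sym (cong +_ (sumWords-χ-∧-false (2 ℕ.* n) (λ w → isDyck w ∧ (returns w ≡ᵇ 1)) (λ w → refl)))

dyckCount≡a : ∀ n p q {P : ℕ → ℕ → Bool} → (∀ v t → P v t ≡ statsAre p q v t) →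
  + dyckCount (2 ℕ.* n) (hasStats P) ≡ a (+ n) p q
dyckCount≡a n p q P≡ = trans (cong +_ (dyckCount-cong (2 ℕ.* n) (λ w → P≡ (valleys w) (tripleFalls w))))
                             (sym (a≡dyckCount n p q))

+-balanced⇒- : ∀ {x y z w} → x ℕ.+ y ≡ z ℕ.+ w → + x ≡ + z - + y + + w
+-balanced⇒- {x} {y} {z} {w} x+y≡z+w = begin
  + x                 ≡⟨ cancel (+ x) (+ y) ⟩
  + x + + y - + y     ≡⟨ cong (_- + y) (sym (pos-+ x y)) ⟩
  + (x ℕ.+ y) - + y   ≡⟨ cong (λ s → + s - + y) x+y≡z+w ⟩
  + (z ℕ.+ w) - + y   ≡⟨ cong (_- + y) (pos-+ z w) ⟩
  + z + + w - + y     ≡⟨ swap (+ z) (+ w) (+ y) ⟩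
  + z - + y + + w     ∎
  where
  open ≡-Reasoning
  open ℤ-Solver using (solve-∀)
  cancel : ∀ x y → x ≡ x + y - y
  cancel = solve-∀
  swap : ∀ z w y → z + w - y ≡ z - y + w
  swap = solve-∀

proposition2 : (n p q : ℤ) → n > + 2 →
    b n p q ≡ a (n - + 1) p (q - + 1) - a (n - + 2) (p - + 1) (q - + 1) + a (n - + 2) (p - + 1) q
proposition2 (+ suc (suc (suc k))) p q _ = begin
  b (+ (3 ℕ.+ k)) p q
    ≡⟨ b≡irreducibleCount (3 ℕ.+ k) p q ⟩
  + irreducibleCount (2 ℕ.* (3 ℕ.+ k)) (hasStats (statsAre p q))
    ≡⟨ +-balanced⇒- (irreducibleCount-recurrence-semilength k (statsAre p q)) ⟩
  + dyckCount (2 ℕ.* (2 ℕ.+ k)) (hasStats (λ v t → (v ≟ᵇ p) ∧ (suc t ≟ᵇ q)))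
    - + dyckCount (2 ℕ.* (1 ℕ.+ k)) (hasStats (λ v t → (suc v ≟ᵇ p) ∧ (suc t ≟ᵇ q)))
    + + dyckCount (2 ℕ.* (1 ℕ.+ k)) (hasStats (λ v t → (suc v ≟ᵇ p) ∧ (t ≟ᵇ q)))
    ≡⟨ cong₂ _+_ (cong₂ _-_ (dyckCount≡a (2 ℕ.+ k) p (q - + 1) (λ v t → cong (v ≟ᵇ p ∧_) (suc-≟ᵇ t q)))
                            (dyckCount≡a (1 ℕ.+ k) (p - + 1) (q - + 1) (λ v t → cong₂ _∧_ (suc-≟ᵇ v p) (suc-≟ᵇ t q))))
                 (dyckCount≡a (1 ℕ.+ k) (p - + 1) q (λ v t → cong (_∧ t ≟ᵇ q) (suc-≟ᵇ v p))) ⟩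
  a (+ (2 ℕ.+ k)) p (q - + 1) - a (+ (1 ℕ.+ k)) (p - + 1) (q - + 1) + a (+ (1 ℕ.+ k)) (p - + 1) q ∎
  where open ≡-Reasoning
proposition2 (+ 0)     p q (+<+ ())
proposition2 (+ 1)     p q (+<+ (s≤s ()))
proposition2 (+ 2)     p q (+<+ (s≤s (s≤s ())))
proposition2 -[1+ n ]  p q ()
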